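{- Let $n$, $k<n$, $m=k$, $d=O(\log n)$ and a constant $\varepsilon>0$ be parameters such that a uniformly random bipartite multigraph with left part $\{0,1\}^n$, right part $\{0,1\}^m$ and left degrees $2^d$ is a $(k,\varepsilon)$-extractor with probability at least a constant $p>0$. Let $N=2^n2^dm$ and let $C$ be a circuit of size $2^{O(n)}$ and constant depth $q$ on $N$ inputs such that $C(G)=1$ for every such graph $G$ (encoded as a string of length $N$) that is a $(k,\varepsilon)$-extractor. Let $NW\colon\{0,1\}^l\to\{0,1\}^N$ be a Nisan–Wigderson generator for depth $q$ as described in the context, with $l=O(\log^{2q+6}N)$. Then for all sufficiently large $n$, $\Pr_u\{C(NW(u))=1\}>p/2$, where $u$ is uniform on $\{0,1\}^l$.
   Context: A graph is encoded as the binary string of length $2^n2^dm$ listing for every left vertex its $2^d$ neighbours; a random graph is a uniformly random such string. With $M=2^m$, $D=2^d$, $K=2^k$, and edges counted with multiplicity, $G$ is a $(k,\varepsilon)$-extractor if for every left set $S$ with $|S|\ge K$ and every right set $Y$, $\left||Y|/M-E(S,Y)/(D|S|)\right|<\varepsilon$, where $E(S,Y)$ is the number of edges from $S$ to $Y$. A Nisan–Wigderson generator for depth $q$ is a family of functions $NW=G_n\colon\{0,1\}^{l}\to\{0,1\}^N$, with $l=\mathrm{poly}(n)$ and $N=2^{O(n)}$, computable in workspace $\mathrm{poly}(n)$, such that for every family of circuits $C_n$ of size $2^{O(n)}$ and depth $q$, every constant $c$ and all sufficiently large $n$, $\left|\Pr_x\{C_n(G_n(x))=1\}-\Pr_y\{C_n(y)=1\}\right|<2^{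 -cn}$, with $x$ uniform on $\{0,1\}^l$ and $y$ uniform on $\{0,1\}^N$.
   Formalization: The constants ε and p are positive rationals instead of positive real numbers. -}

module Defs where

open import Data.Bool using (Bool; true; false; not; _∨_; _∧_; if_then_else_)
open import Data.Nat as ℕ using (ℕ; zero; suc; _+_; _*_; _∸_; _^_; _≤ᵇ_)
open import Data.Bool.ListAction using (all; any)
open import Data.Nat.ListAction using (sum)
open import Data.List using (List; []; _∷_; [_]; _++_; length; map; upTo; filterᵇ; take; drop; concatMap; foldl; foldr; replicate)
open import Data.Vec as Vec using (Vec; toList)
import Data.Integer as ℤ
open import Data.Rational as ℚ using (ℚ; 0ℚ; _-_; ∣_∣)
open import Data.Rational.Properties using (_<?_)
open import Relation.Nullary.Decidable using (does)

-- a / b as a rational; (only used with b ≠ 0; returns 0 when b = 0)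
frac : ℕ → ℕ → ℚ
frac a zero = 0ℚ
frac a (suc b) = ℤ.+ a ℚ./ suc b

bits : (N : ℕ) → List (Vec Bool N)
bits zero = [ Vec.[] ]
bits (suc N) = concatMap (λ v → (false Vec.∷ v) ∷ (true Vec.∷ v) ∷ []) (bits N)

count : {A : Set} → (A → Bool) → List A → ℕ
count p xs = length (filterᵇ p xs)

Pr : (N : ℕ) → (Vec Bool N → Bool) → ℚ
Pr N P = frac (count P (bits N)) (2 ^ N)

-- i-th entry of a bit list (false when out of range)
at : List Bool → ℕ → Bool
at [] i = false
at (b ∷ bs) zero = b
at (b ∷ bs) (suc i) = at bs i

-- the natural number encoded (big-endian) by a bit list;
-- this identifies {0,1}^m with {0,…,2^m-1}
toNat : List Bool → ℕ
toNat = foldl (λ acc b → 2 * acc + (if b then 1 else 0)) 0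

bool→ℕ : Bool → ℕ
bool→ℕ true = 1
bool→ℕ false = 0

-- Bipartite multigraphs: left {0,1}^n, right {0,1}^m, left degree 2^d,
-- encoded as a string of length 2^n 2^d m listing, for every left vertex x
-- (in order), its 2^d neighbours, each written with m bits.

GraphLen : ℕ → ℕ → ℕ → ℕ
GraphLen n d m = 2 ^ n * 2 ^ d * m

nbr : (n d m : ℕ) → Vec Bool (GraphLen n d m) → ℕ → ℕ → ℕ
nbr n d m G x j = toNat (take m (drop ((x * 2 ^ d + j) * m) (toList G)))

-- E(S,Y): number of edges (with multiplicity) from S to Y;
-- S ⊆ {0,1}^n and Y ⊆ {0,1}^m given by characteristic vectors
edges : (n d m : ℕ) → Vec Bool (GraphLen n d m) →
        Vec Bool (2 ^ n) → Vec Bool (2 ^ m) → ℕ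
edges n d m G S Y =
  sum (map (λ x → bool→ℕ (at (toList S) x) *
                  sum (map (λ j → bool→ℕ (at (toList Y) (nbr n d m G x j)))
                           (upTo (2 ^ d))))
           (upTo (2 ^ n)))

-- G is a (k,ε)-extractor: for every S with |S| ≥ 2^k and every Y,
-- | |Y|/M - E(S,Y)/(D|S|) | < ε.
isExtractor : (n d m k : ℕ) → ℚ → Vec Bool (GraphLen n d m) → Bool
isExtractor n d m k ε G =
  all (λ S → not (2 ^ k ≤ᵇ count (λ b → b) (toList S)) ∨
             all (λ Y → does (∣ frac (count (λ b → b) (toList Y)) (2 ^ m)
                               - frac (edges n d m G S Y)
                                      (2 ^ d * count (λ b → b) (toList S)) ∣
                              <? ε))
                 (bits (2 ^ m)))
      (bits (2 ^ n))

-- Boolean circuits (unbounded fan-in AND / OR, NOT), as DAGs.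
-- A circuit on N inputs is a list of gates g₀, g₁, …; the wires of gate i
-- are indices w < N + i, where w < N denotes input w and w = N + j denotes
-- the output of gate j.  The output of the circuit is its last gate.
-- (AND with no wires is the constant true, OR with no wires is false.)

data GateType : Set where
  AND OR NOT : GateType

record Gate : Set where
  constructor gate
  field
    type  : GateType
    wires : List ℕ
open Gate public

Circuit : Set
Circuit = List Gate

-- well-formedness of a circuit on N inputs whose first i gates precede it
WFfrom : ℕ → ℕ → Circuit → Bool
WFfrom N i [] = true
WFfrom N i (g ∷ gs) =
  all (λ w → suc w ≤ᵇ N + i) (wires g) ∧ arity g ∧ WFfrom N (suc i) gs
  where
  arity : Gate → Bool
  arity (gate NOT (_ ∷ [])) = true
  arity (gate NOT _) = false
  arity (gate AND _) = true
  arity (gate OR _) = true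

WF : ℕ → Circuit → Bool
WF N [] = false
WF N C@(_ ∷ _) = WFfrom N 0 C

size : Circuit → ℕ
size = length

evalGate : List Bool → Gate → Bool
evalGate vs (gate AND ws) = all (at vs) ws
evalGate vs (gate OR ws) = any (at vs) ws
evalGate vs (gate NOT []) = true
evalGate vs (gate NOT (w ∷ _)) = not (at vs w)

evalAll : List Bool → Circuit → List Bool
evalAll vs [] = vs
evalAll vs (g ∷ gs) = evalAll (vs ++ [ evalGate vs g ]) gs

eval : {N : ℕ} → Circuit → Vec Bool N → Bool
eval {N} C x = at (evalAll (toList x) C) (N + length C ∸ 1)

atℕ : List ℕ → ℕ → ℕ
atℕ [] i = 0
atℕ (b ∷ bs) zero = b
atℕ (b ∷ bs) (suc i) = atℕ bs i

depthAll : List ℕ → Circuit → List ℕ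
depthAll ds [] = ds
depthAll ds (g ∷ gs) =
  depthAll (ds ++ [ suc (foldr ℕ._⊔_ 0 (map (atℕ ds) (wires g))) ]) gs

depth : ℕ → Circuit → ℕ
depth N C = atℕ (depthAll (replicate N 0) C) (N + length C ∸ 1)

open import Data.Bool using (T)
open import Data.Nat using (_≤_)
open import Data.Product using (_×_; ∃-syntax)
open import Data.Rational using () renaming (_<_ to _<ℚ_)

SizeDepthFamily : (Nf : ℕ → ℕ) (q : ℕ) (C : ℕ → Circuit) → Set
SizeDepthFamily Nf q C =
  (∀ n → T (WF (Nf n) (C n))) ×
  (∀ n → depth (Nf n) (C n) ≤ q) ×
  (∃[ c ] ∀ n → size (C n) ≤ c * 2 ^ (c * n))

-- The workspace-poly(n) computability requirement is omitted.
IsNW : (q : ℕ) (l Nf : ℕ → ℕ) (G : (n : ℕ) → Vec Bool (l n) → Vec Bool (Nf n)) → Set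
IsNW q l Nf G =
  (∃[ a ] ∀ n → l n ≤ a * n ^ a + a) ×
  (∃[ a ] ∀ n → Nf n ≤ a * 2 ^ (a * n)) ×
  (∀ (C : ℕ → Circuit) → SizeDepthFamily Nf q C → ∀ (c : ℕ) →
     ∃[ n₀ ] ∀ n → n₀ ≤ n →
       ∣ Pr (l n) (λ x → eval (C n) (G n x)) - Pr (Nf n) (λ y → eval (C n) y) ∣
         <ℚ frac 1 (2 ^ (c * n)))

-- A random graph is an extractor with probability at least p, and C accepts
-- every extractor, so Pr_y {C y = 1} ≥ p.  The circuit family C has size
-- 2^{O(n)} and depth q, so NW fools it with error 2^{-Kn} for any fixed K;
-- choosing K so that 2^{-Kn} ≤ p/2 leaves Pr_u {C (NW u) = 1} > p - p/2.
module Submission where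

open import Defs
open import Data.Bool using (Bool; T; true; false)
open import Data.Nat using (ℕ; zero; suc; _+_; _*_; _^_; _≤_; _<_; _⊔_; z≤n; s≤s; NonZero; >-nonZero)
open import Data.Nat.Logarithm using (⌊log₂_⌋)
open import Data.Nat.Properties as ℕ
  using (m≤n⇒m≤1+n; <⇒≤; ^-monoʳ-≤; m≤m*n; m^n>0; m⊔n≤o⇒m≤o; m⊔n≤o⇒n≤o)
open import Data.List using (List; []; _∷_)
open import Data.Vec using (Vec)
open import Data.Product using (_,_; ∃-syntax)
import Data.Integer as ℤ
import Data.Integer.Properties as ℤ
open import Data.Rational
  using (ℚ; mkℚ; 0ℚ; ½; ∣_∣; _-_; *≤*; *<*; positive)
  renaming (_+_ to _+ℚ_; _<_ to _<ℚ_; _≤_ to _≤ℚ_; _*_ to _*ℚ_)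
open import Data.Rational.Properties
  using (≤-refl; ≤-trans; ≤-<-trans; toℚᵘ-cancel-≤; toℚᵘ-fromℚᵘ; +-mono-≤; +-monoˡ-<;
         neg-antimono-≤; ∣-p∣≡∣p∣; +-0-abelianGroup; positive⁻¹; pos*pos⇒pos;
         module ≤-Reasoning)
import Data.Rational.Unnormalised as ℚᵘ
import Data.Rational.Unnormalised.Properties as ℚᵘ
open import Data.Rational.Solver using (module +-*-Solver)
open import Algebra.Properties.AbelianGroup +-0-abelianGroup using (⁻¹-anti-homo‿-)
open import Relation.Binary.PropositionalEquality using (_≡_; refl; subst; sym; trans; cong)
open import Data.Empty using (⊥-elim)

count-mono : {A : Set} (P Q : A → Bool) → (∀ x → T (P x) → T (Q x)) →
             (xs : List A) → count P xs ≤ count Q xs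
count-mono P Q P⇒Q [] = z≤n
count-mono P Q P⇒Q (x ∷ xs) with P x in eqP | Q x in eqQ
... | true  | true  = s≤s (count-mono P Q P⇒Q xs)
... | false | true  = m≤n⇒m≤1+n (count-mono P Q P⇒Q xs)
... | false | false = count-mono P Q P⇒Q xs
... | true  | false = ⊥-elim (subst T eqQ (P⇒Q x (subst T (sym eqP) _)))

frac-monoˡ-≤ : ∀ {a b} M → a ≤ b → frac a M ≤ℚ frac b M
frac-monoˡ-≤ zero    a≤b = ≤-refl
frac-monoˡ-≤ {a} {b} (suc m) a≤b = toℚᵘ-cancel-≤
  (ℚᵘ.≤-respʳ-≃ (ℚᵘ.≃-sym (toℚᵘ-fromℚᵘ (ℚᵘ.mkℚᵘ (ℤ.+ b) m)))
  (ℚᵘ.≤-respˡ-≃ (ℚᵘ.≃-sym (toℚᵘ-fromℚᵘ (ℚᵘ.mkℚᵘ (ℤ.+ a) m)))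
    (ℚᵘ.*≤* (ℤ.*-monoʳ-≤-nonNeg (ℤ.+ suc m) (ℤ.+≤+ a≤b)))))

Pr-mono : ∀ N (P Q : Vec Bool N → Bool) → (∀ x → T (P x) → T (Q x)) → Pr N P ≤ℚ Pr N Q
Pr-mono N P Q P⇒Q = frac-monoˡ-≤ (2 ^ N) (count-mono P Q P⇒Q (bits N))

-- For r = (a+1)/(d+1) the threshold d+1 works: d+1 ≤ (a+1)M once d+1 ≤ M.
frac-1-eventually-≤ : ∀ r → 0ℚ <ℚ r → ∃[ K ] ∀ M → K ≤ M → frac 1 M ≤ℚ r
frac-1-eventually-≤ (mkℚ (ℤ.+ zero) d _) (*<* (ℤ.+<+ ()))
frac-1-eventually-≤ (mkℚ ℤ.-[1+ a ] d _) (*<* ())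
frac-1-eventually-≤ r@(mkℚ ℤ.+[1+ a ] d _) _ = suc d , bound
  where
  bound : ∀ M → suc d ≤ M → frac 1 M ≤ℚ r
  bound (suc b) (s≤s d≤b) = toℚᵘ-cancel-≤
    (ℚᵘ.≤-respˡ-≃ (ℚᵘ.≃-sym (toℚᵘ-fromℚᵘ (ℚᵘ.mkℚᵘ (ℤ.+ 1) b)))
      (ℚᵘ.*≤* (ℤ.+≤+ (s≤s (subst (_≤ b + a * suc b) (sym (ℕ.+-identityʳ d))
                                 (ℕ.≤-trans d≤b (ℕ.m≤m+n b (a * suc b))))))))

n<2^n : ∀ n → n < 2 ^ n
n<2^n zero    = s≤s z≤n
n<2^n (suc n) = subst (suc n <_) (cong (2 ^ n +_) (sym (ℕ.+-identityʳ (2 ^ n))))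
                      (ℕ.+-mono-≤ (m^n>0 2 n) (n<2^n n))

m<2^[m*n] : ∀ m n .{{_ : NonZero n}} → m < 2 ^ (m * n)
m<2^[m*n] m n = ℕ.<-≤-trans (n<2^n m) (^-monoʳ-≤ 2 (m≤m*n m n))

p≤∣p∣ : ∀ p → p ≤ℚ ∣ p ∣
p≤∣p∣ (mkℚ (ℤ.+ n) _ _)    = ≤-refl
p≤∣p∣ (mkℚ ℤ.-[1+ n ] _ _) = *≤* ℤ.-≤+

open +-*-Solver

∣p-q∣<r⇒q-r<p : ∀ {p q r} → ∣ p - q ∣ <ℚ r → q - r <ℚ p
∣p-q∣<r⇒q-r<p {p} {q} {r} ∣p-q∣<r = begin-strict
  q - r              ≡⟨ solve 3 (λ p q r → q :- r := (q :- p) :+ (p :- r)) refl p q r ⟩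
  (q - p) +ℚ (p - r) <⟨ +-monoˡ-< (p - r) q-p<r ⟩
  r +ℚ (p - r)       ≡⟨ solve 2 (λ p r → r :+ (p :- r) := p) refl p r ⟩
  p                  ∎
  where
  open ≤-Reasoning
  q-p<r : q - p <ℚ r
  q-p<r = ≤-<-trans (p≤∣p∣ (q - p))
            (subst (_<ℚ r) (trans (sym (∣-p∣≡∣p∣ (p - q))) (cong ∣_∣ (⁻¹-anti-homo‿- p q))) ∣p-q∣<r)

0<p⇒0<p*½ : ∀ {p} → 0ℚ <ℚ p → 0ℚ <ℚ p *ℚ ½
0<p⇒0<p*½ {p} 0<p = positive⁻¹ _ {{pos*pos⇒pos p {{positive 0<p}} ½}}

halved-lower-bound : ∀ {p q r e} → p ≤ℚ q → e ≤ℚ p *ℚ ½ → ∣ r - q ∣ <ℚ e → p *ℚ ½ <ℚ r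
halved-lower-bound {p} {q} {r} {e} p≤q e≤p/2 ∣r-q∣<e = begin-strict
  p *ℚ ½     ≡⟨ solve 1 (λ p → p :* con ½ := p :- p :* con ½) refl p ⟩
  p - p *ℚ ½ ≤⟨ +-mono-≤ p≤q (neg-antimono-≤ e≤p/2) ⟩
  q - e      <⟨ ∣p-q∣<r⇒q-r<p ∣r-q∣<e ⟩
  r          ∎
  where open ≤-Reasoning

lemma7 : (k d : ℕ → ℕ) (ε p : ℚ) (q n₀ : ℕ) →
    0ℚ <ℚ ε → 0ℚ <ℚ p →
    (∀ n → n₀ ≤ n → k n < n) →
    (∃[ c ] ∀ n → n₀ ≤ n → d n ≤ c * ⌊log₂ n ⌋ + c) →
    (∀ n → n₀ ≤ n →
       p ≤ℚ Pr (GraphLen n (d n) (k n)) (isExtractor n (d n) (k n) (k n) ε)) →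
    (C : ℕ → Circuit) →
    SizeDepthFamily (λ n → GraphLen n (d n) (k n)) q C →
    (∀ n → n₀ ≤ n → (G : Vec Bool (GraphLen n (d n) (k n))) →
       T (isExtractor n (d n) (k n) (k n) ε G) → T (eval (C n) G)) →
    (l : ℕ → ℕ) (NW : (n : ℕ) → Vec Bool (l n) → Vec Bool (GraphLen n (d n) (k n))) →
    IsNW q l (λ n → GraphLen n (d n) (k n)) NW →
    (∃[ a ] ∀ n → l n ≤ a * ⌊log₂ GraphLen n (d n) (k n) ⌋ ^ (2 * q + 6) + a) →
    ∃[ n₁ ] ∀ n → n₁ ≤ n → p *ℚ ½ <ℚ Pr (l n) (λ u → eval (C n) (NW n u))
lemma7 k d ε p q n₀ _ 0<p _ _ extractor-likely C family accepts-extractors l NW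
       (_ , _ , fools) _
  with K , small ← frac-1-eventually-≤ (p *ℚ ½) (0<p⇒0<p*½ 0<p)
  with n₂ , fooled ← fools C family K
  = n₀ ⊔ n₂ ⊔ 1 , λ n n₁≤n →
    let n₀⊔n₂≤n = m⊔n≤o⇒m≤o (n₀ ⊔ n₂) 1 n₁≤n
        n₀≤n    = m⊔n≤o⇒m≤o n₀ n₂ n₀⊔n₂≤n
        instance _ = >-nonZero (m⊔n≤o⇒n≤o (n₀ ⊔ n₂) 1 n₁≤n)
    in halved-lower-bound
         (≤-trans (extractor-likely n n₀≤n)
                  (Pr-mono _ _ _ (accepts-extractors n n₀≤n)))
         (small (2 ^ (K * n)) (<⇒≤ (m<2^[m*n] K n)))
         (fooled n (m⊔n≤o⇒n≤o n₀ n₂ n₀⊔n₂≤n))
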